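{- If $i \ge 2$ is an integer with $C(i) = 0$, then $\sigma_\infty(8i-4) = \sigma_\infty(8i-3) = \sigma_\infty(8i-2)$.
   Context: $T:\mathbb{Z}^+\to\mathbb{Z}^+$ is defined by $T(x) = x/2$ if $x$ is even and $T(x) = (3x+1)/2$ if $x$ is odd; $T^k$ denotes the $k$-fold iterate, $T^0$ the identity. For $x \in \mathbb{Z}^+$, $\sigma_\infty(x)$ is the least $k \ge 0$ with $T^k(x) = 1$, and $\sigma_\infty(x) = \infty$ if no such $k$ exists. The function $C:\mathbb{Z}^+\to\{0,1\}$ is defined recursively by $C(1) = 0$, $C(n) = 1 - C(n-2)$ if $n > 1$ is odd, and $C(n) = 1 - C(n/2)$ if $n$ is even. -}

module Defs where

open import Data.Nat using (ℕ; zero; suc; _+_; _*_; _<_; ⌊_/2⌋)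
open import Data.Bool using (Bool; true; false; if_then_else_)
open import Data.Nat using (_∸_)
open import Data.Product using (_×_)
open import Function.Bundles using (_⇔_)
open import Relation.Binary.PropositionalEquality using (_≡_; _≢_)

isEven : ℕ → Bool
isEven zero = true
isEven (suc zero) = false
isEven (suc (suc n)) = isEven n

-- The Collatz map T (on ℕ; only its values on positive integers matter).
T : ℕ → ℕ
T x = if isEven x then ⌊ x /2⌋ else ⌊ (3 * x + 1) /2⌋

T^ : ℕ → ℕ → ℕ
T^ zero x = x
T^ (suc k) x = T (T^ k x)

-- "σ_∞(x) = k": k is the least k ≥ 0 with T^k(x) = 1.
StopsAt : ℕ → ℕ → Set
StopsAt x k = (T^ k x ≡ 1) × (∀ j → j < k → T^ j x ≢ 1)

-- σ_∞(x) = σ_∞(y) as elements of ℕ ∪ {∞}: they have the same finite value,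
-- or both are ∞ (neither has any finite value).
SameSigma : ℕ → ℕ → Set
SameSigma x y = ∀ k → StopsAt x k ⇔ StopsAt y k

-- C(n) computed with fuel; fuel n suffices for C n, since each recursive call
-- (n-2 or n/2, for n ≥ 2) strictly decreases the argument.
Cf : ℕ → ℕ → ℕ
Cf zero n = 0
Cf (suc f) zero = 0
Cf (suc f) (suc zero) = 0
Cf (suc f) (suc (suc m)) =
  if isEven m then 1 ∸ Cf f ⌊ suc (suc m) /2⌋ else 1 ∸ Cf f m

-- C(1) = 0, C(n) = 1 - C(n-2) for odd n > 1, C(n) = 1 - C(n/2) for even n.
C : ℕ → ℕ
C n = Cf n n

{-# OPTIONS --safe #-}
-- Write i = 2^a u with u odd. After three steps 8i−4 and 8i−3 both reach 3i−1, while 8i−2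
-- reaches 3(3i−1)+2. As 3i = 2^a·3u, the next a steps from 3i−1 are odd steps, along which
-- x ↦ 3x+2 commutes with T; they end at 3^(a+1)u−1 and 3(3^(a+1)u−1)+2. Unfolding the
-- recursion of C shows C(i) = 0 exactly when 3^(a+1)u ≡ 3 (mod 4), and then two halvings on
-- each side lead to a common value. A trajectory that has hit 1 only visits 1 and 2, so a common
-- value ≥ 3 (guaranteed by i ≥ 2) means neither side reaches 1 before the trajectories merge.
module Submission where

open import Data.Bool using (true; false)
open import Data.List using ([]; _∷_)
open import Data.Nat using (ℕ; zero; suc; _+_; _*_; _∸_; _^_; _≤_; _<_; ⌊_/2⌋; z≤n; s≤s)
open import Data.Nat.Induction using (<-rec)
open import Data.Nat.Properties
open import Algebra.Properties.CommutativeSemigroup *-commutativeSemigroup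
  using (x∙yz≈y∙xz; x∙yz≈yx∙z)
open import Data.Nat.Tactic.RingSolver using (solve)
open import Data.Product using (_×_; _,_; proj₁; proj₂; ∃-syntax)
open import Data.Sum using (_⊎_; inj₁; inj₂)
open import Function.Bundles using (mk⇔)
open import Relation.Binary.PropositionalEquality
open import Relation.Nullary using (contradiction; yes; no)

open import Defs

even⊎odd : ∀ n → ∃[ k ] (n ≡ 2 * k ⊎ n ≡ 1 + 2 * k)
even⊎odd zero = 0 , inj₁ refl
even⊎odd (suc n) with even⊎odd n
... | k , inj₁ refl = k , inj₂ refl
... | k , inj₂ refl = suc k , inj₁ (sym (*-suc 2 k))

isEven-double : ∀ k → isEven (2 * k) ≡ true
isEven-double zero = refl
isEven-double (suc k) rewrite *-suc 2 k = isEven-double k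

isEven-odd : ∀ k → isEven (1 + 2 * k) ≡ false
isEven-odd zero = refl
isEven-odd (suc k) = subst (λ n → isEven (suc n) ≡ false) (sym (*-suc 2 k)) (isEven-odd k)

⌊2*n/2⌋≡n : ∀ n → ⌊ 2 * n /2⌋ ≡ n
⌊2*n/2⌋≡n zero = refl
⌊2*n/2⌋≡n (suc n) rewrite *-suc 2 n = cong suc (⌊2*n/2⌋≡n n)

T-double : ∀ k → T (2 * k) ≡ k
T-double k rewrite isEven-double k = ⌊2*n/2⌋≡n k

T-odd : ∀ k → T (1 + 2 * k) ≡ 2 + 3 * k
T-odd k rewrite isEven-odd k = begin
  ⌊ 3 * (1 + 2 * k) + 1 /2⌋  ≡⟨ cong ⌊_/2⌋ (solve (k ∷ [])) ⟩
  ⌊ 2 * (2 + 3 * k) /2⌋      ≡⟨ ⌊2*n/2⌋≡n (2 + 3 * k) ⟩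
  2 + 3 * k                   ∎
  where open ≡-Reasoning

T^-+ : ∀ j m x → T^ (j + m) x ≡ T^ j (T^ m x)
T^-+ zero m x = refl
T^-+ (suc j) m x = cong T (T^-+ j m x)

T^-split : ∀ {m j} x → m ≤ j → T^ j x ≡ T^ (j ∸ m) (T^ m x)
T^-split {m} {j} x m≤j = trans (cong (λ k → T^ k x) (sym (m∸n+n≡m m≤j))) (T^-+ (j ∸ m) m x)

T^-sucʳ : ∀ s x → T^ (suc s) x ≡ T^ s (T x)
T^-sucʳ zero x = refl
T^-sucʳ (suc s) x = cong T (T^-sucʳ s x)

T^-1≡1⊎2 : ∀ k → T^ k 1 ≡ 1 ⊎ T^ k 1 ≡ 2
T^-1≡1⊎2 zero = inj₁ refl
T^-1≡1⊎2 (suc k) with T^ k 1 | T^-1≡1⊎2 k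
... | _ | inj₁ refl = inj₂ refl
... | _ | inj₂ refl = inj₁ refl

T^-1≤2 : ∀ k → T^ k 1 ≤ 2
T^-1≤2 k with T^-1≡1⊎2 k
... | inj₁ e = ≤-trans (≤-reflexive e) (n≤1+n 1)
... | inj₂ e = ≤-reflexive e

T^≡1⇒later≤2 : ∀ {j m} x → j ≤ m → T^ j x ≡ 1 → T^ m x ≤ 2
T^≡1⇒later≤2 {j} {m} x j≤m hit =
  subst (_≤ 2) (sym (trans (T^-split x j≤m) (cong (T^ (m ∸ j)) hit))) (T^-1≤2 (m ∸ j))

merged-T^≡1 : ∀ m {x y} → T^ m x ≡ T^ m y → 3 ≤ T^ m x → ∀ j → T^ j x ≡ 1 → T^ j y ≡ 1
merged-T^≡1 m {x} {y} eq 3≤ j hit with m ≤? j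
... | no m≰j = contradiction (T^≡1⇒later≤2 x (<⇒≤ (≰⇒> m≰j)) hit) (<⇒≱ 3≤)
... | yes m≤j = begin
  T^ j y                 ≡⟨ T^-split y m≤j ⟩
  T^ (j ∸ m) (T^ m y)    ≡⟨ cong (T^ (j ∸ m)) (sym eq) ⟩
  T^ (j ∸ m) (T^ m x)    ≡⟨ sym (T^-split x m≤j) ⟩
  T^ j x                 ≡⟨ hit ⟩
  1                      ∎
  where open ≡-Reasoning

stopsAt-transfer : ∀ {x y} → (∀ j → T^ j x ≡ 1 → T^ j y ≡ 1) → (∀ j → T^ j y ≡ 1 → T^ j x ≡ 1) →
  ∀ k → StopsAt x k → StopsAt y k
stopsAt-transfer x→y y→x k (hit , before) = x→y k hit , λ j j<k e → before j j<k (y→x j e)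

sameSigma-merge : ∀ m {x y} → T^ m x ≡ T^ m y → 3 ≤ T^ m x → SameSigma x y
sameSigma-merge m eq 3≤ k = mk⇔ (stopsAt-transfer x→y y→x k) (stopsAt-transfer y→x x→y k)
  where
  x→y = merged-T^≡1 m eq 3≤
  y→x = merged-T^≡1 m (sym eq) (subst (3 ≤_) eq 3≤)

suc≡2*⇒odd : ∀ {x q} → suc x ≡ 2 * q → ∃[ k ] (x ≡ 1 + 2 * k × suc k ≡ q)
suc≡2*⇒odd {q = suc k} e = k , suc-injective (trans e (solve (k ∷ []))) , refl

T-2+3*odd : ∀ k → T (2 + 3 * (1 + 2 * k)) ≡ 2 + 3 * T (1 + 2 * k)
T-2+3*odd k = begin
  T (2 + 3 * (1 + 2 * k))    ≡⟨ cong T odd-form ⟩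
  T (1 + 2 * (2 + 3 * k))    ≡⟨ T-odd (2 + 3 * k) ⟩
  2 + 3 * (2 + 3 * k)        ≡⟨ cong (λ t → 2 + 3 * t) (sym (T-odd k)) ⟩
  2 + 3 * T (1 + 2 * k)      ∎
  where
  open ≡-Reasoning
  odd-form : 2 + 3 * (1 + 2 * k) ≡ 1 + 2 * (2 + 3 * k)
  odd-form = solve (k ∷ [])

-- Each step of the run is an odd step, with T(x) + 1 = 3(x + 1)/2.
oddRun : ∀ s {x c} → suc x ≡ 2 ^ s * c →
  suc (T^ s x) ≡ 3 ^ s * c × T^ s (2 + 3 * x) ≡ 2 + 3 * T^ s x
oddRun zero e = e , refl
oddRun (suc s) {x} {c} e with suc≡2*⇒odd {q = 2 ^ s * c} (trans e (*-assoc 2 (2 ^ s) c))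
... | k , refl , suc-k≡2^s*c = run , companion
  where
  open ≡-Reasoning
  suc-Tx : suc (T x) ≡ 2 ^ s * (3 * c)
  suc-Tx = begin
    suc (T (1 + 2 * k))   ≡⟨ cong suc (T-odd k) ⟩
    3 + 3 * k             ≡⟨ sym (*-suc 3 k) ⟩
    3 * suc k             ≡⟨ cong (3 *_) suc-k≡2^s*c ⟩
    3 * (2 ^ s * c)       ≡⟨ x∙yz≈y∙xz 3 (2 ^ s) c ⟩
    2 ^ s * (3 * c)       ∎
  ih = oddRun s suc-Tx
  run : suc (T^ (suc s) x) ≡ 3 ^ suc s * c
  run = begin
    suc (T^ (suc s) x)    ≡⟨ cong suc (T^-sucʳ s x) ⟩
    suc (T^ s (T x))      ≡⟨ proj₁ ih ⟩
    3 ^ s * (3 * c)       ≡⟨ x∙yz≈yx∙z (3 ^ s) 3 c ⟩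
    3 ^ suc s * c         ∎
  companion : T^ (suc s) (2 + 3 * x) ≡ 2 + 3 * T^ (suc s) x
  companion = begin
    T^ (suc s) (2 + 3 * x)   ≡⟨ T^-sucʳ s (2 + 3 * x) ⟩
    T^ s (T (2 + 3 * x))     ≡⟨ cong (T^ s) (T-2+3*odd k) ⟩
    T^ s (2 + 3 * T x)       ≡⟨ proj₂ ih ⟩
    2 + 3 * T^ s (T x)       ≡⟨ cong (λ t → 2 + 3 * t) (sym (T^-sucʳ s x)) ⟩
    2 + 3 * T^ (suc s) x     ∎

oddRun-merge : ∀ a {x c v} → suc x ≡ 2 ^ a * c → 3 ^ a * c ≡ 3 + 4 * v →
  T^ (2 + a) x ≡ 2 + 3 * v × T^ (2 + a) (2 + 3 * x) ≡ 2 + 3 * v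
oddRun-merge a {x} {c} {v} suc-x≡2^a*c 3^a*c≡3+4v = left , right
  where
  open ≡-Reasoning
  run = oddRun a suc-x≡2^a*c
  end-of-run : T^ a x ≡ 2 * (1 + 2 * v)
  end-of-run = suc-injective (trans (proj₁ run) (trans 3^a*c≡3+4v (solve (v ∷ []))))
  left : T (T (T^ a x)) ≡ 2 + 3 * v
  left = begin
    T (T (T^ a x))             ≡⟨ cong (λ t → T (T t)) end-of-run ⟩
    T (T (2 * (1 + 2 * v)))    ≡⟨ cong T (T-double (1 + 2 * v)) ⟩
    T (1 + 2 * v)              ≡⟨ T-odd v ⟩
    2 + 3 * v                  ∎
  companion-end : T^ a (2 + 3 * x) ≡ 2 * (2 * (2 + 3 * v))
  companion-end = begin
    T^ a (2 + 3 * x)           ≡⟨ proj₂ run ⟩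
    2 + 3 * T^ a x             ≡⟨ cong (λ t → 2 + 3 * t) end-of-run ⟩
    2 + 3 * (2 * (1 + 2 * v))  ≡⟨ solve (v ∷ []) ⟩
    2 * (2 * (2 + 3 * v))      ∎
  right : T (T (T^ a (2 + 3 * x))) ≡ 2 + 3 * v
  right = begin
    T (T (T^ a (2 + 3 * x)))      ≡⟨ cong (λ t → T (T t)) companion-end ⟩
    T (T (2 * (2 * (2 + 3 * v)))) ≡⟨ cong T (T-double (2 * (2 + 3 * v))) ⟩
    T (2 * (2 + 3 * v))           ≡⟨ T-double (2 + 3 * v) ⟩
    2 + 3 * v                     ∎

Cf-fuel-irrelevant : ∀ {f g} n → n ≤ f → n ≤ g → Cf f n ≡ Cf g n
Cf-fuel-irrelevant {zero} {zero} zero _ _ = refl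
Cf-fuel-irrelevant {zero} {suc g} zero _ _ = refl
Cf-fuel-irrelevant {suc f} {zero} zero _ _ = refl
Cf-fuel-irrelevant {suc f} {suc g} zero _ _ = refl
Cf-fuel-irrelevant {suc f} {suc g} (suc zero) _ _ = refl
Cf-fuel-irrelevant {suc f} {suc g} (suc (suc m)) (s≤s m<f) (s≤s m<g) with isEven m
... | true  = cong (1 ∸_) (Cf-fuel-irrelevant {f} {g} (suc ⌊ m /2⌋)
  (≤-trans (s≤s (⌊n/2⌋≤n m)) m<f) (≤-trans (s≤s (⌊n/2⌋≤n m)) m<g))
... | false = cong (1 ∸_) (Cf-fuel-irrelevant {f} {g} m (<⇒≤ m<f) (<⇒≤ m<g))

C-double : ∀ k → C (2 * suc k) ≡ 1 ∸ C (suc k)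
C-double k rewrite *-suc 2 k | isEven-double k | ⌊2*n/2⌋≡n k =
  cong (1 ∸_) (Cf-fuel-irrelevant (suc k) (s≤s (m≤n*m k 2)) ≤-refl)

C-odd-step : ∀ k → C (1 + 2 * suc k) ≡ 1 ∸ C (1 + 2 * k)
C-odd-step k = trans (cong (λ n → C (suc n)) (*-suc 2 k)) C-3+2k
  where
  C-3+2k : C (3 + 2 * k) ≡ 1 ∸ C (1 + 2 * k)
  C-3+2k rewrite isEven-odd k = cong (1 ∸_) (Cf-fuel-irrelevant (1 + 2 * k) (n≤1+n _) ≤-refl)

Matches : ℕ → ℕ → Set
Matches c r = (c ≡ 0 × ∃[ v ] r ≡ 3 + 4 * v) ⊎ (c ≡ 1 × ∃[ v ] r ≡ 1 + 4 * v)

matches-flip-6+ : ∀ {c r} → Matches c r → Matches (1 ∸ c) (6 + r)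
matches-flip-6+ (inj₁ (refl , v , refl)) = inj₂ (refl , 2 + v , solve (v ∷ []))
matches-flip-6+ (inj₂ (refl , v , refl)) = inj₁ (refl , 1 + v , solve (v ∷ []))

matches-flip-3* : ∀ {c r} → Matches c r → Matches (1 ∸ c) (3 * r)
matches-flip-3* (inj₁ (refl , v , refl)) = inj₂ (refl , 2 + 3 * v , solve (v ∷ []))
matches-flip-3* (inj₂ (refl , v , refl)) = inj₁ (refl , 3 * v , solve (v ∷ []))

C-odd-matches : ∀ u → Matches (C (1 + 2 * u)) (3 * (1 + 2 * u))
C-odd-matches zero = inj₁ (refl , 0 , refl)
C-odd-matches (suc u) =
  subst₂ Matches (sym (C-odd-step u)) residue (matches-flip-6+ (C-odd-matches u))
  where
  residue : 6 + 3 * (1 + 2 * u) ≡ 3 * (1 + 2 * suc u)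
  residue = solve (u ∷ [])

OddPartMatches : ℕ → Set
OddPartMatches n =
  ∃[ a ] ∃[ u ] (n ≡ 2 ^ a * (1 + 2 * u) × Matches (C n) (3 ^ a * (3 * (1 + 2 * u))))

C-oddPartMatches : ∀ n → OddPartMatches (suc n)
C-oddPartMatches = <-rec (λ n → OddPartMatches (suc n)) go
  where
  go : ∀ n → (∀ {m} → m < n → OddPartMatches (suc m)) → OddPartMatches (suc n)
  go n rec with even⊎odd n
  ... | k , inj₁ refl =
    0 , k , sym (*-identityˡ _) , subst (Matches _) (sym (*-identityˡ _)) (C-odd-matches k)
  ... | k , inj₂ refl with rec {k} (s≤s (m≤n*m k 2))
  ... | a , u , suc-k≡2^a*U , matches =
    suc a , u , twoAdic , subst₂ Matches C-2+2k residue (matches-flip-3* matches)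
    where
    open ≡-Reasoning
    U = 1 + 2 * u
    twoAdic : 2 + 2 * k ≡ 2 ^ suc a * U
    twoAdic = begin
      2 + 2 * k          ≡⟨ sym (*-suc 2 k) ⟩
      2 * suc k          ≡⟨ cong (2 *_) suc-k≡2^a*U ⟩
      2 * (2 ^ a * U)    ≡⟨ sym (*-assoc 2 (2 ^ a) U) ⟩
      2 ^ suc a * U      ∎
    C-2+2k : 1 ∸ C (suc k) ≡ C (2 + 2 * k)
    C-2+2k = sym (trans (cong C (sym (*-suc 2 k))) (C-double k))
    residue : 3 * (3 ^ a * (3 * U)) ≡ 3 ^ suc a * (3 * U)
    residue = sym (*-assoc 3 (3 ^ a) (3 * U))

T³-4w : ∀ w → T^ 3 (2 * (2 * w)) ≡ T w
T³-4w w = trans (cong (λ t → T (T t)) (T-double (2 * w))) (cong T (T-double w))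

T³-4w+1 : ∀ m → T^ 3 (1 + 2 * (2 * (1 + 2 * m))) ≡ T (1 + 2 * m)
T³-4w+1 m = begin
  T (T (T (1 + 2 * (2 * w))))    ≡⟨ cong (λ t → T (T t)) (T-odd (2 * w)) ⟩
  T (T (2 + 3 * (2 * w)))        ≡⟨ cong (λ t → T (T t)) quadruple ⟩
  T (T (2 * (2 * (2 + 3 * m))))  ≡⟨ cong T (T-double (2 * (2 + 3 * m))) ⟩
  T (2 * (2 + 3 * m))            ≡⟨ T-double (2 + 3 * m) ⟩
  2 + 3 * m                      ≡⟨ sym (T-odd m) ⟩
  T w                            ∎
  where
  open ≡-Reasoning
  w = 1 + 2 * m
  quadruple : 2 + 3 * (2 * (1 + 2 * m)) ≡ 2 * (2 * (2 + 3 * m))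
  quadruple = solve (m ∷ [])

T³-4w+2 : ∀ m → T^ 3 (2 * (1 + 2 * (1 + 2 * m))) ≡ 2 + 3 * T (1 + 2 * m)
T³-4w+2 m = begin
  T (T (T (2 * (1 + 2 * w))))    ≡⟨ cong (λ t → T (T t)) (T-double (1 + 2 * w)) ⟩
  T (T (1 + 2 * w))              ≡⟨ cong T (T-odd w) ⟩
  T (2 + 3 * w)                  ≡⟨ T-2+3*odd m ⟩
  2 + 3 * T w                    ∎
  where
  open ≡-Reasoning
  w = 1 + 2 * m

sameSigma-4w-4w+1 : ∀ m → 1 ≤ m → SameSigma (2 * (2 * (1 + 2 * m))) (1 + 2 * (2 * (1 + 2 * m)))
sameSigma-4w-4w+1 m 1≤m = sameSigma-merge 3 (trans (T³-4w w) (sym (T³-4w+1 m))) 3≤T³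
  where
  w = 1 + 2 * m
  3≤T³ : 3 ≤ T^ 3 (2 * (2 * w))
  3≤T³ = subst (3 ≤_) (sym (trans (T³-4w w) (T-odd m))) (+-monoʳ-≤ 2 (≤-trans 1≤m (m≤n*m m 3)))

2^a*c≤3^a*c : ∀ a c → 2 ^ a * c ≤ 3 ^ a * c
2^a*c≤3^a*c a c = *-monoˡ-≤ c (^-monoˡ-≤ a (n≤1+n 2))

sameSigma-4w+1-4w+2 : ∀ m → 1 ≤ m → C (suc m) ≡ 0 →
  SameSigma (1 + 2 * (2 * (1 + 2 * m))) (2 * (1 + 2 * (1 + 2 * m)))
sameSigma-4w+1-4w+2 m 1≤m C≡0 with C-oddPartMatches m
... | _ , _ , _ , inj₂ (C≡1 , _) = contradiction (trans (sym C≡0) C≡1) λ ()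
... | a , u , suc-m≡2^a*U , inj₁ (_ , v , 3^a*3U≡3+4v) =
  sameSigma-merge (2 + a + 3) (trans Y-meets (sym Z-meets))
    (subst (3 ≤_) (sym Y-meets) (3≤2+3v v 6≤3+4v))
  where
  open ≡-Reasoning
  U = 1 + 2 * u
  w = 1 + 2 * m
  3[1+m]≡2^a*3U : 3 * suc m ≡ 2 ^ a * (3 * U)
  3[1+m]≡2^a*3U = trans (cong (3 *_) suc-m≡2^a*U) (x∙yz≈y∙xz 3 (2 ^ a) U)
  suc-Tw : suc (T w) ≡ 2 ^ a * (3 * U)
  suc-Tw = begin
    suc (T w)        ≡⟨ cong suc (T-odd m) ⟩
    3 + 3 * m        ≡⟨ sym (*-suc 3 m) ⟩
    3 * suc m        ≡⟨ 3[1+m]≡2^a*3U ⟩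
    2 ^ a * (3 * U)  ∎
  merged = oddRun-merge a {v = v} suc-Tw 3^a*3U≡3+4v
  Y-meets : T^ (2 + a + 3) (1 + 2 * (2 * w)) ≡ 2 + 3 * v
  Y-meets = trans (T^-+ (2 + a) 3 _) (trans (cong (T^ (2 + a)) (T³-4w+1 m)) (proj₁ merged))
  Z-meets : T^ (2 + a + 3) (2 * (1 + 2 * w)) ≡ 2 + 3 * v
  Z-meets = trans (T^-+ (2 + a) 3 _) (trans (cong (T^ (2 + a)) (T³-4w+2 m)) (proj₂ merged))
  6≤3+4v : 6 ≤ 3 + 4 * v
  6≤3+4v = ≤-Reasoning.begin
    6                ≤-Reasoning.≤⟨ *-monoʳ-≤ 3 (s≤s 1≤m) ⟩
    3 * suc m        ≤-Reasoning.≡⟨ 3[1+m]≡2^a*3U ⟩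
    2 ^ a * (3 * U)  ≤-Reasoning.≤⟨ 2^a*c≤3^a*c a (3 * U) ⟩
    3 ^ a * (3 * U)  ≤-Reasoning.≡⟨ 3^a*3U≡3+4v ⟩
    3 + 4 * v        ≤-Reasoning.∎
  3≤2+3v : ∀ k → 6 ≤ 3 + 4 * k → 3 ≤ 2 + 3 * k
  3≤2+3v zero (s≤s (s≤s (s≤s ())))
  3≤2+3v (suc k) _ = s≤s (s≤s (s≤s z≤n))

x≡k+y⇒x∸k≡y : ∀ k {x} y → x ≡ k + y → x ∸ k ≡ y
x≡k+y⇒x∸k≡y k y refl = m+n∸m≡n k y

corollary5p6 : (i : ℕ) → 2 ≤ i → C i ≡ 0 →
    SameSigma (8 * i ∸ 4) (8 * i ∸ 3) × SameSigma (8 * i ∸ 3) (8 * i ∸ 2)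
corollary5p6 (suc zero) (s≤s ())
corollary5p6 (suc (suc n)) _ C≡0 =
    subst₂ SameSigma (sym 8i-4) (sym 8i-3) (sameSigma-4w-4w+1 m (s≤s z≤n))
  , subst₂ SameSigma (sym 8i-3) (sym 8i-2) (sameSigma-4w+1-4w+2 m (s≤s z≤n) C≡0)
  where
  m = suc n
  8i-4 : 8 * (2 + n) ∸ 4 ≡ 2 * (2 * (1 + 2 * m))
  8i-4 = x≡k+y⇒x∸k≡y 4 {8 * (2 + n)} (2 * (2 * (1 + 2 * suc n))) (solve (n ∷ []))
  8i-3 : 8 * (2 + n) ∸ 3 ≡ 1 + 2 * (2 * (1 + 2 * m))
  8i-3 = x≡k+y⇒x∸k≡y 3 {8 * (2 + n)} (1 + 2 * (2 * (1 + 2 * suc n))) (solve (n ∷ []))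
  8i-2 : 8 * (2 + n) ∸ 2 ≡ 2 * (1 + 2 * (1 + 2 * m))
  8i-2 = x≡k+y⇒x∸k≡y 2 {8 * (2 + n)} (2 * (1 + 2 * (1 + 2 * suc n))) (solve (n ∷ []))
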